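{- Let $A,I$ be finite sets, $L\subseteq A^I$, and $X,Y\subseteq I$ with $X\cup Y=I$ such that $X$ and $Y$ decompose $L$. If $K$ is a minimal simplicial complex generating $L$, then every maximal simplex of $K$ that intersects both $X$ and $Y$ intersects $X\cap Y$.
   Context: For finite sets $A,I$, a language is a subset $L\subseteq A^I$. For finite sets $B,J$ and a function $f:B^J\to A^I$, the input window $\mathcal{W}_f(i)\subseteq J$ of $i\in I$ is the smallest $W\subseteq J$ such that for all $x,y\in B^J$ agreeing on $W$, $f(x)_i=f(y)_i$. The communication complex $K_f$ is the simplicial complex on vertex set $I$ whose simplices are the sets $S\subseteq I$ with $\bigcap_{i\in S}\mathcal{W}_f(i)\neq\emptyset$. A simplicial complex $K$ on $I$ generates $L$ if there exist finite sets $B,J$ and $f:B^J\to A^I$ with $f(B^J)=L$ and $K_f\subseteq K$; $K$ is minimal generating $L$ if it generates $L$ and no complex properly contained in $K$ generates $L$. Sets $X,Y\subseteq I$ with $X\cup Y=I$ decompose $L$ if for every $w\in A^I$ such that both restrictions $w|_X$ and $w|_Y$ have extensions in $L$, one has $w\in L$. -}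

module Defs where

open import Data.Nat using (ℕ)
open import Data.Fin using (Fin)
open import Data.Fin.Subset using (Subset; _∈_; _⊆_)
open import Data.Bool using (Bool; true; false)
open import Data.Product using (Σ; ∃; _×_; _,_)
open import Data.Sum using (_⊎_)
open import Relation.Nullary using (¬_)
open import Relation.Binary.PropositionalEquality using (_≡_)
open import Function.Bundles using (_⇔_)

Word : ℕ → ℕ → Set
Word a n = Fin n → Fin a

Language : ℕ → ℕ → Set
Language a n = Word a n → Bool

Family : ℕ → Set
Family n = Subset n → Bool

IsComplex : ∀ {n} → Family n → Set
IsComplex {n} K = ∀ (S T : Subset n) → S ⊆ T → K T ≡ true → K S ≡ true

AgreeOn : ∀ {b m} → Subset m → Word b m → Word b m → Set
AgreeOn W x y = ∀ j → j ∈ W → x j ≡ y j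

Determines : ∀ {a n b m} → (Word b m → Word a n) → Fin n → Subset m → Set
Determines f i W = ∀ x y → AgreeOn W x y → f x i ≡ f y i

IsWindow : ∀ {a n b m} → (Word b m → Word a n) → Fin n → Subset m → Set
IsWindow {m = m} f i W =
  Determines f i W × (∀ (W' : Subset m) → Determines f i W' → W ⊆ W')

ImageIs : ∀ {a n b m} → (Word b m → Word a n) → Language a n → Set
ImageIs f L = ∀ w → (L w ≡ true) ⇔ (∃ λ x → ∀ i → f x i ≡ w i)

-- Communication complex K_f (given the windows W i = W_f(i)) is contained in K:
-- every S with ⋂_{i∈S} W i ≠ ∅ lies in K.
CommContained : ∀ {n m} → (Fin n → Subset m) → Family n → Set
CommContained {n} {m} W K =
  ∀ (S : Subset n) → (∃ λ (j : Fin m) → ∀ i → i ∈ S → j ∈ W i) → K S ≡ true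

Generates : ∀ {a n} → Family n → Language a n → Set
Generates {a} {n} K L =
  Σ ℕ λ b → Σ ℕ λ m → Σ (Word b m → Word a n) λ f → Σ (Fin n → Subset m) λ W →
    (∀ i → IsWindow f i (W i)) × ImageIs f L × CommContained W K

MinimalGenerating : ∀ {a n} → Family n → Language a n → Set
MinimalGenerating {a} {n} K L =
  IsComplex K × Generates K L ×
  (∀ (K' : Family n) → IsComplex K' → (∀ S → K' S ≡ true → K S ≡ true) →
     (∃ λ S → K S ≡ true × K' S ≡ false) → ¬ Generates K' L)

MaximalSimplex : ∀ {n} → Family n → Subset n → Set
MaximalSimplex {n} K σ = K σ ≡ true × (∀ (T : Subset n) → K T ≡ true → σ ⊆ T → T ⊆ σ)

Meets : ∀ {n} → Subset n → Subset n → Set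
Meets S T = ∃ λ i → i ∈ S × i ∈ T

Covers : ∀ {n} → Subset n → Subset n → Set
Covers X Y = ∀ i → i ∈ X ⊎ i ∈ Y

AgreeOnI : ∀ {a n} → Subset n → Word a n → Word a n → Set
AgreeOnI X u w = ∀ i → i ∈ X → u i ≡ w i

Decomposes : ∀ {a n} → Subset n → Subset n → Language a n → Set
Decomposes X Y L =
  ∀ w → (∃ λ u → L u ≡ true × AgreeOnI X u w) →
        (∃ λ v → L v ≡ true × AgreeOnI Y v w) → L w ≡ true

-- Suppose σ meets X and Y but not X ∩ Y, and let f generate L inside K. Duplicate every
-- input of f: outputs in X read the first copy of each input, outputs outside X read the
-- second copy of exactly those inputs read by all of σ. By maximality such an input is read
-- by vertices of σ only, hence by no output in X ∩ Y. The new image contains L (feed equal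
-- copies), and every word in it agrees on X with one word of L and on Y with another, so it
-- is in L by decomposability. No input is now read both by a vertex of σ ∩ X and by one of
-- σ ∖ X, so the new communication complex avoids every superset of σ: K minus the open star
-- of σ still generates L, contradicting minimality.
module Submission where

open import Defs
open import Data.Nat using (ℕ; _+_)
open import Data.Fin using (Fin; _↑ˡ_; _↑ʳ_; splitAt; _≟_)
open import Data.Fin.Properties using (splitAt-↑ˡ; splitAt-↑ʳ; any?)
open import Data.Fin.Subset using (Subset; _∩_; _∈_; _⊆_)
open import Data.Fin.Subset.Properties using (_∈?_; _⊆?_; x∈p∩q⁺)
open import Data.Vec using (tabulate)
open import Data.Vec.Properties using (lookup∘tabulate; []=⇒lookup; lookup⇒[]=)
open import Data.Bool using (Bool; true; false; _∧_; not; if_then_else_)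
open import Data.Bool.Properties using (∧-zeroʳ)
open import Data.Product using (∃; _×_; _,_; proj₁; proj₂)
open import Data.Sum using ([_,_]′)
open import Data.Empty using (⊥-elim)
open import Function using (id; const; _∘_)
open import Function.Bundles using (mk⇔; Equivalence)
open import Level using (0ℓ)
open import Relation.Nullary using (¬_; yes; no; does)
open import Relation.Nullary.Decidable using (_×-dec_; dec-true; dec-false)
open import Relation.Unary using (Pred; Decidable)
open import Relation.Binary.PropositionalEquality

subset : ∀ {n} {P : Pred (Fin n) 0ℓ} → Decidable P → Subset n
subset P? = tabulate (λ i → does (P? i))

∈-subset⁺ : ∀ {n} {P : Pred (Fin n) 0ℓ} (P? : Decidable P) {i} → P i → i ∈ subset P?
∈-subset⁺ P? {i} p = lookup⇒[]= i _ (trans (lookup∘tabulate _ i) (dec-true (P? i) p))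

∈-subset⁻ : ∀ {n} {P : Pred (Fin n) 0ℓ} (P? : Decidable P) {i} → i ∈ subset P? → P i
∈-subset⁻ P? {i} i∈ with P? i | trans (sym (lookup∘tabulate (λ i → does (P? i)) i)) ([]=⇒lookup i∈)
... | yes p | _ = p
... | no _ | ()

image : ∀ {m m'} → (Fin m → Fin m') → Subset m → Subset m'
image g S = subset (λ k → any? (λ j → (j ∈? S) ×-dec (g j ≟ k)))

∈-image⁺ : ∀ {m m'} (g : Fin m → Fin m') {S j} → j ∈ S → g j ∈ image g S
∈-image⁺ g {S} {j} j∈S = ∈-subset⁺ (λ k → any? (λ j → (j ∈? S) ×-dec (g j ≟ k))) (j , j∈S , refl)

∈-image⁻ : ∀ {m m'} (g : Fin m → Fin m') {S k} → k ∈ image g S → ∃ λ j → j ∈ S × g j ≡ k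
∈-image⁻ g {S} = ∈-subset⁻ (λ k → any? (λ j → (j ∈? S) ×-dec (g j ≟ k)))

preimage : ∀ {m m'} → (Fin m → Fin m') → Subset m' → Subset m
preimage g D = subset (λ j → g j ∈? D)

determines-≗ : ∀ {a n b m} {f : Word b m → Word a n} {i W} →
  Determines f i W → ∀ {x y} → (∀ j → x j ≡ y j) → f x i ≡ f y i
determines-≗ det {x} {y} x≗y = det x y (λ j _ → x≗y j)

module Rewiring {a n b m m'} (f : Word b m → Word a n) (W : Fin n → Subset m)
  (windows : ∀ i → IsWindow f i (W i))
  (wire : Fin n → Fin m → Fin m') (retract : Fin m' → Fin m)
  (retract-wire : ∀ i j → retract (wire i j) ≡ j) where

  rewired : Word b m' → Word a n
  rewired z i = f (λ j → z (wire i j)) i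

  rewiredWindow : Fin n → Subset m'
  rewiredWindow i = image (wire i) (W i)

  rewired-∘retract : ∀ x i → rewired (x ∘ retract) i ≡ f x i
  rewired-∘retract x i = determines-≗ {f = f} (proj₁ (windows i)) (λ j → cong x (retract-wire i j))

  ∈-rewiredWindow⁻ : ∀ {i k} → k ∈ rewiredWindow i → retract k ∈ W i × wire i (retract k) ≡ k
  ∈-rewiredWindow⁻ {i} k∈ with ∈-image⁻ (wire i) k∈
  ... | j , j∈W , refl rewrite retract-wire i j = j∈W , refl

  rewiredWindow-determines : ∀ i → Determines rewired i (rewiredWindow i)
  rewiredWindow-determines i x y x≈y =
    proj₁ (windows i) _ _ (λ j j∈W → x≈y (wire i j) (∈-image⁺ (wire i) j∈W))

  preimage-determines : ∀ i D → Determines rewired i D → Determines f i (preimage (wire i) D)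
  preimage-determines i D D-det x y x≈y = begin
    f x i             ≡⟨ sym (rewired-∘retract x i) ⟩
    rewired x' i      ≡⟨ D-det x' y' x'≈y' ⟩
    rewired y' i      ≡⟨ determines-≗ {f = f} (proj₁ (windows i)) y'-wire ⟩
    f y i             ∎
    where
    open ≡-Reasoning
    x' : Word _ m'
    x' = x ∘ retract
    y' : Word _ m'
    y' k with wire i (retract k) ≟ k
    ... | yes _ = y (retract k)
    ... | no _ = x (retract k)
    y'-wire : ∀ j → y' (wire i j) ≡ y j
    y'-wire j with wire i (retract (wire i j)) ≟ wire i j
    ... | yes _ = cong y (retract-wire i j)
    ... | no ≢ = ⊥-elim (≢ (cong (wire i) (retract-wire i j)))
    x'≈y' : AgreeOn D x' y'
    x'≈y' k k∈D with wire i (retract k) ≟ k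
    ... | yes wired = x≈y (retract k) (∈-subset⁺ (λ j → wire i j ∈? D) (subst (_∈ D) (sym wired) k∈D))
    ... | no _ = refl

  rewiredWindow-minimal : ∀ i D → Determines rewired i D → rewiredWindow i ⊆ D
  rewiredWindow-minimal i D D-det k∈ with ∈-image⁻ (wire i) k∈
  ... | j , j∈W , refl =
    ∈-subset⁻ (λ j → wire i j ∈? D) (proj₂ (windows i) _ (preimage-determines i D D-det) j∈W)

  rewired-window : ∀ i → IsWindow rewired i (rewiredWindow i)
  rewired-window i = rewiredWindow-determines i , rewiredWindow-minimal i

copy : ∀ m → Bool → Fin m → Fin (m + m)
copy m false j = j ↑ˡ m
copy m true j = m ↑ʳ j

original : ∀ m → Fin (m + m) → Fin m
original m k = [ id , id ]′ (splitAt m k)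

copyTag : ∀ m → Fin (m + m) → Bool
copyTag m k = [ const false , const true ]′ (splitAt m k)

original-copy : ∀ m s j → original m (copy m s j) ≡ j
original-copy m false j rewrite splitAt-↑ˡ m j m = refl
original-copy m true j rewrite splitAt-↑ʳ m m j = refl

copyTag-copy : ∀ m s j → copyTag m (copy m s j) ≡ s
copyTag-copy m false j rewrite splitAt-↑ˡ m j m = refl
copyTag-copy m true j rewrite splitAt-↑ʳ m m j = refl

copy-injectiveˡ : ∀ m {s t j k} → copy m s j ≡ copy m t k → s ≡ t
copy-injectiveˡ m {s} {t} {j} {k} eq = begin
  s                      ≡⟨ sym (copyTag-copy m s j) ⟩
  copyTag m (copy m s j) ≡⟨ cong (copyTag m) eq ⟩
  copyTag m (copy m t k) ≡⟨ copyTag-copy m t k ⟩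
  t                      ∎
  where open ≡-Reasoning

deleteStar : ∀ {n} → Family n → Subset n → Family n
deleteStar K σ S = K S ∧ not (does (σ ⊆? S))

deleteStar⁺ : ∀ {n} (K : Family n) σ {S} → K S ≡ true → ¬ σ ⊆ S → deleteStar K σ S ≡ true
deleteStar⁺ K σ {S} KS σ⊈S rewrite KS | dec-false (σ ⊆? S) σ⊈S = refl

deleteStar⁻ : ∀ {n} (K : Family n) σ {S} → deleteStar K σ S ≡ true → K S ≡ true × ¬ σ ⊆ S
deleteStar⁻ K σ {S} h with K S | σ ⊆? S | h
... | true | no σ⊈S | _ = refl , σ⊈S
... | true | yes _ | ()
... | false | _ | ()

deleteStar-isComplex : ∀ {n} {K : Family n} σ → IsComplex K → IsComplex (deleteStar K σ)
deleteStar-isComplex {K = K} σ K-complex S T S⊆T T∈ with deleteStar⁻ K σ T∈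
... | KT , σ⊈T = deleteStar⁺ K σ (K-complex S T S⊆T KT) (λ σ⊆S → σ⊈T (S⊆T ∘ σ⊆S))

deleteStar-self : ∀ {n} (K : Family n) σ → deleteStar K σ σ ≡ false
deleteStar-self K σ rewrite dec-true (σ ⊆? σ) id = ∧-zeroʳ (K σ)

minimal-deleteStar : ∀ {a n} {K : Family n} {L : Language a n} {σ} →
  MinimalGenerating K L → K σ ≡ true → ¬ Generates (deleteStar K σ) L
minimal-deleteStar {K = K} {σ = σ} (K-complex , _ , minimal) Kσ =
  minimal (deleteStar K σ) (deleteStar-isComplex σ K-complex) (λ _ → proj₁ ∘ deleteStar⁻ K σ)
    (σ , Kσ , deleteStar-self K σ)

module Splitting {a n} {L : Language a n} {X Y : Subset n} (decomposes : Decomposes X Y L)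
  {K : Family n} {σ : Subset n} (maximal : MaximalSimplex K σ)
  (σ∩X∩Y=∅ : ¬ Meets σ (X ∩ Y))
  {p} (p∈σ : p ∈ σ) (p∈X : p ∈ X) {q} (q∈σ : q ∈ σ) (q∈Y : q ∈ Y)
  {b m} {f : Word b m → Word a n} {W : Fin n → Subset m}
  (windows : ∀ i → IsWindow f i (W i)) (f-image : ImageIs f L) (comm : CommContained W K) where

  readers : Fin m → Subset n
  readers j = subset (λ i → j ∈? W i)

  ∈-readers⁺ : ∀ {i} j → j ∈ W i → i ∈ readers j
  ∈-readers⁺ j = ∈-subset⁺ (λ i → j ∈? W i)

  ∈-readers⁻ : ∀ {i} j → i ∈ readers j → j ∈ W i
  ∈-readers⁻ j = ∈-subset⁻ (λ i → j ∈? W i)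

  readers-⊆σ : ∀ j → σ ⊆ readers j → readers j ⊆ σ
  readers-⊆σ j = proj₂ maximal (readers j) (comm (readers j) (j , λ _ → ∈-readers⁻ j))

  readBySimplex : Fin m → Bool
  readBySimplex j = does (σ ⊆? readers j)

  copyFor : Fin n → Fin m → Bool
  copyFor i j = if does (i ∈? X) then false else readBySimplex j

  copyFor-∈X : ∀ {i} j → i ∈ X → copyFor i j ≡ false
  copyFor-∈X {i} _ i∈X rewrite dec-true (i ∈? X) i∈X = refl

  copyFor-∉X : ∀ {i} j → ¬ i ∈ X → copyFor i j ≡ readBySimplex j
  copyFor-∉X {i} _ i∉X rewrite dec-false (i ∈? X) i∉X = refl

  open Rewiring f W windows (λ i j → copy m (copyFor i j) j) (original m)
    (λ i j → original-copy m (copyFor i j) j)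

  first second : Word b (m + m) → Word b m
  first z j = z (copy m false j)
  second z j = z (copy m (readBySimplex j) j)

  rewired-∈X : ∀ {i} z → i ∈ X → rewired z i ≡ f (first z) i
  rewired-∈X {i} z i∈X =
    determines-≗ {f = f} (proj₁ (windows i)) (λ j → cong (λ s → z (copy m s j)) (copyFor-∈X j i∈X))

  rewired-∉X : ∀ {i} z → ¬ i ∈ X → rewired z i ≡ f (second z) i
  rewired-∉X {i} z i∉X =
    determines-≗ {f = f} (proj₁ (windows i)) (λ j → cong (λ s → z (copy m s j)) (copyFor-∉X j i∉X))

  first≈second : ∀ {i} z → i ∈ X → i ∈ Y → AgreeOn (W i) (first z) (second z)
  first≈second {i} z i∈X i∈Y j j∈W with σ ⊆? readers j
  ... | no _ = refl
  ... | yes σ⊆readers =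
    ⊥-elim (σ∩X∩Y=∅ (i , readers-⊆σ j σ⊆readers (∈-readers⁺ j j∈W) ,
                        x∈p∩q⁺ (i∈X , i∈Y)))

  f-∈L : ∀ x → L (f x) ≡ true
  f-∈L x = Equivalence.from (f-image (f x)) (x , λ _ → refl)

  rewired-image : ImageIs rewired L
  rewired-image w = mk⇔ image⊇L image⊆L
    where
    image⊇L : L w ≡ true → ∃ λ z → ∀ i → rewired z i ≡ w i
    image⊇L w∈L with Equivalence.to (f-image w) w∈L
    ... | x , fx≡w = x ∘ original m , λ i → trans (rewired-∘retract x i) (fx≡w i)
    image⊆L : (∃ λ z → ∀ i → rewired z i ≡ w i) → L w ≡ true
    image⊆L (z , rz≡w) =
      decomposes w (f (first z) , f-∈L (first z) , agreeX)
                   (f (second z) , f-∈L (second z) , agreeY)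
      where
      agreeX : AgreeOnI X (f (first z)) w
      agreeX i i∈X = trans (sym (rewired-∈X z i∈X)) (rz≡w i)
      agreeY : AgreeOnI Y (f (second z)) w
      agreeY i i∈Y with i ∈? X
      ... | yes i∈X = trans (sym (proj₁ (windows i) _ _ (first≈second z i∈X i∈Y))) (agreeX i i∈X)
      ... | no i∉X = trans (sym (rewired-∉X z i∉X)) (rz≡w i)

  rewired-comm : CommContained rewiredWindow (deleteStar K σ)
  rewired-comm S (k , k∈) = deleteStar⁺ K σ (comm S (j , λ i i∈S → proj₁ (wired i∈S))) σ⊈S
    where
    j : Fin m
    j = original m k
    wired : ∀ {i} → i ∈ S → j ∈ W i × copy m (copyFor i j) j ≡ k
    wired i∈S = ∈-rewiredWindow⁻ (k∈ _ i∈S)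
    -- p ∈ X reads the first copy of j, whereas q ∉ X would read its second copy.
    σ⊈S : ¬ σ ⊆ S
    σ⊈S σ⊆S = false≢true (begin
      false           ≡⟨ sym (copyFor-∈X j p∈X) ⟩
      copyFor p j     ≡⟨ copy-injectiveˡ m (trans (proj₂ (wired (σ⊆S p∈σ)))
                                                (sym (proj₂ (wired (σ⊆S q∈σ))))) ⟩
      copyFor q j     ≡⟨ copyFor-∉X j q∉X ⟩
      readBySimplex j ≡⟨ dec-true (σ ⊆? readers j) σ⊆readers ⟩
      true            ∎)
      where
      open ≡-Reasoning
      q∉X : ¬ q ∈ X
      q∉X q∈X = σ∩X∩Y=∅ (q , q∈σ , x∈p∩q⁺ (q∈X , q∈Y))
      σ⊆readers : σ ⊆ readers j
      σ⊆readers i∈σ = ∈-readers⁺ j (proj₁ (wired (σ⊆S i∈σ)))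
      false≢true : false ≢ true
      false≢true ()

  deleteStar-generates : Generates (deleteStar K σ) L
  deleteStar-generates =
    b , m + m , rewired , rewiredWindow , rewired-window , rewired-image , rewired-comm

theorem4p2 : ∀ (a n : ℕ) (L : Language a n) (X Y : Subset n) →
    Covers X Y → Decomposes X Y L →
    (K : Family n) → MinimalGenerating K L →
    (σ : Subset n) → MaximalSimplex K σ → Meets σ X → Meets σ Y →
    Meets σ (X ∩ Y)
theorem4p2 a n L X Y _ decomposes K minimal@(_ , (b , m , f , W , windows , f-image , comm) , _)
  σ maximal (p , p∈σ , p∈X) (q , q∈σ , q∈Y) with any? (λ i → (i ∈? σ) ×-dec (i ∈? X ∩ Y))
... | yes σ∩X∩Y = σ∩X∩Y
... | no σ∩X∩Y=∅ = ⊥-elim (minimal-deleteStar minimal (proj₁ maximal)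
  (Splitting.deleteStar-generates decomposes maximal σ∩X∩Y=∅ p∈σ p∈X q∈σ q∈Y windows f-image comm))
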